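{- Let $n\ge 0$ and let $\mathcal{L}\subseteq\{0,1\}^n$. Then $\mathcal{L}$ is a bubble language if and only if, for every $d=0,\dots,n$, the set $\mathcal{L}\cap\mathcal{B}^n_d$ is closed under taking parents and under taking left siblings in the tree $T^n_d$. In particular, if $\mathcal{L}\cap\mathcal{B}^n_d\neq\emptyset$, then $\mathcal{L}\cap\mathcal{B}^n_d$ is the vertex set of a subtree of $T^n_d$ rooted at $1^d0^{n-d}$.
   Context: A language $\mathcal{L}\subseteq\{0,1\}^*$ is a bubble language if, for every $w\in\mathcal{L}$ that contains the factor $01$, the word obtained by replacing the first occurrence of $01$ in $w$ by $10$ also belongs to $\mathcal{L}$. $\mathcal{B}^n_d$ is the set of binary words of length $n$ with exactly $d$ ones. Every word $w\neq 1^n$ can be written uniquely as $w=1^s0^t\gamma$ with $s\ge0$, $t\ge1$, and $\gamma$ either empty or beginning with $1$. The rooted tree $T^n_d$ has vertex set $\mathcal{B}^n_d$ and root $1^d0^{n-d}$. A vertex $1^s0^t\gamma$ with $s>0$ and $t>0$ has exactly $t$ children, ordered from left to right. For $i=1,\dots,t$, its $i$-th child is $1^{s-1}0^i10^{t-i}\gamma$. All other vertices are leaves. -}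

module Defs where

open import Data.Bool using (Bool; true; false)
open import Data.Nat using (ℕ; zero; suc; _+_; _∸_; _≤_; _<_)
open import Data.List using (List; []; _∷_; _++_; replicate; length)
open import Data.Product using (Σ; _×_; ∃)
open import Data.Sum using (_⊎_)
open import Relation.Binary.PropositionalEquality using (_≡_)
open import Relation.Nullary using (¬_)

-- Binary words: lists of booleans, with true = 1 and false = 0.
Word : Set
Word = List Bool

Language : Set₁
Language = Word → Set

ones : Word → ℕ
ones []          = 0
ones (true ∷ w)  = suc (ones w)
ones (false ∷ w) = ones w

Has01 : Word → Set
Has01 w = Σ Word λ u → Σ Word λ v → w ≡ u ++ (false ∷ true ∷ v)

-- Bubble language: whenever w = x 01 y with the displayed 01 being the
-- first occurrence of 01 in w (equivalently: x has no factor 01),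
-- then x 10 y ∈ L.
IsBubble : Language → Set
IsBubble L = (x y : Word) → ¬ Has01 x →
  L (x ++ (false ∷ true ∷ y)) → L (x ++ (true ∷ false ∷ y))

InB : ℕ → ℕ → Word → Set
InB n d w = (length w ≡ n) × (ones w ≡ d)

Slice : Language → ℕ → ℕ → Language
Slice L n d w = L w × InB n d w

EmptyOrStarts1 : Word → Set
EmptyOrStarts1 γ = (γ ≡ []) ⊎ (Σ Word λ γ' → γ ≡ true ∷ γ')

root : ℕ → ℕ → Word
root n d = replicate d true ++ replicate (n ∸ d) false

-- IsChild w i v : v is the i-th child (1 ≤ i ≤ t) of w in the tree,
-- where w = 1^s 0^t γ (unique decomposition, s > 0 written as suc s)
-- and v = 1^(s-1) 0^i 1 0^(t-i) γ.
IsChild : Word → ℕ → Word → Set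
IsChild w i v =
  Σ ℕ λ s → Σ ℕ λ t → Σ Word λ γ →
    EmptyOrStarts1 γ × (1 ≤ i) × (i ≤ t) ×
    (w ≡ replicate (suc s) true ++ replicate t false ++ γ) ×
    (v ≡ replicate s true ++ replicate i false ++ (true ∷ replicate (t ∸ i) false ++ γ))

ParentClosed : Language → Set
ParentClosed S = (w v : Word) (i : ℕ) → IsChild w i v → S v → S w

LeftSiblingClosed : Language → Set
LeftSiblingClosed S = (w v u : Word) (i j : ℕ) →
  IsChild w i v → IsChild w j u → j < i → S v → S u

-- S is the vertex set of a subtree of T^n_d rooted at 1^d 0^(n-d):
-- it contains the root and is closed under parents (hence connected,
-- since every vertex's path to the root goes through parents).
IsRootedSubtree : ℕ → ℕ → Language → Set
IsRootedSubtree n d S = S (root n d) × ParentClosed S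

-- The i-th child 1^s 0^i 1 0^(t-i) γ of 1^(s+1) 0^t γ makes sense also for i = 0, where it is the
-- parent itself.  The first 01 of the i-th child (i ≥ 1) is the one ending at its displayed 1,
-- and swapping it gives the (i-1)-th child.  So a bubble language is exactly one that is closed
-- under lowering the child index, i.e. under parents (i ↦ 0) and left siblings (i ↦ j < i); and
-- every word x 01 y with x free of 01 is such a child, which gives the converse.  Bubbling every
-- 1 to the front sorts a word into the root 1^d 0^(n-d).
module Submission where

open import Defs
open import Data.Bool using (Bool; true; false)
open import Data.Nat using (ℕ; zero; suc; _+_; _∸_; _≤_; _<_; _≤′_; ≤′-refl; ≤′-step; z≤n; s≤s)
open import Data.Nat.Properties
  using (+-suc; +-identityʳ; +-∸-assoc; m+n∸m≡n; m+n∸n≡m; m+[n∸m]≡n; n∸n≡0; m≤m+n; m≤n+m; n≤1+n;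
         ≤-refl; ≤-trans; <⇒≤; ≤⇒≤′; m≤n⇒m<n∨m≡n)
open import Data.List using ([]; _∷_; _++_; replicate; length)
open import Data.List.Properties using (++-assoc; ++-identityʳ; length-++; ∷-injectiveʳ)
open import Data.Product using (Σ; ∃₂; _×_; _,_; proj₁; proj₂)
open import Data.Sum using (inj₁; inj₂)
open import Data.Empty using (⊥-elim)
open import Function using (_∘_)
open import Function.Bundles using (_⇔_; mk⇔)
open import Relation.Nullary using (¬_)
open import Relation.Binary.PropositionalEquality 
  using (_≡_; refl; sym; trans; cong; subst; subst₂; module ≡-Reasoning)
open ≡-Reasoning

infix 8 1^_ 0^_

1^_ 0^_ : ℕ → Word
1^ n = replicate n true
0^ n = replicate n false

replicate-snoc : ∀ n (b : Bool) w → replicate (suc n) b ++ w ≡ replicate n b ++ b ∷ w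
replicate-snoc zero    b w = refl
replicate-snoc (suc n) b w = cong (b ∷_) (replicate-snoc n b w)

zeros : Word → ℕ
zeros []          = 0
zeros (true ∷ w)  = zeros w
zeros (false ∷ w) = suc (zeros w)

zeros+ones≡length : ∀ w → zeros w + ones w ≡ length w
zeros+ones≡length []          = refl
zeros+ones≡length (true ∷ w)  = trans (+-suc (zeros w) (ones w)) (cong suc (zeros+ones≡length w))
zeros+ones≡length (false ∷ w) = cong suc (zeros+ones≡length w)

ones≤length : ∀ w → ones w ≤ length w
ones≤length w = subst (ones w ≤_) (zeros+ones≡length w) (m≤n+m (ones w) (zeros w))

zeros≡length∸ones : ∀ {n d} w → InB n d w → zeros w ≡ n ∸ d
zeros≡length∸ones w (refl , refl) = begin
  zeros w                        ≡⟨ sym (m+n∸n≡m (zeros w) (ones w)) ⟩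
  zeros w + ones w ∸ ones w      ≡⟨ cong (_∸ ones w) (zeros+ones≡length w) ⟩
  length w ∸ ones w              ∎

ones-swap : ∀ x y → ones (x ++ true ∷ false ∷ y) ≡ ones (x ++ false ∷ true ∷ y)
ones-swap []          y = refl
ones-swap (true ∷ x)  y = cong suc (ones-swap x y)
ones-swap (false ∷ x) y = ones-swap x y

slice-isBubble : ∀ L n d → IsBubble L → IsBubble (Slice L n d)
slice-isBubble L n d bubble x y no01 (l , len , on) =
  bubble x y no01 l ,
  trans (trans (length-++ x) (sym (length-++ x))) len ,
  trans (ones-swap x y) on

Has01-∷ : ∀ b {w} → Has01 w → Has01 (b ∷ w)
Has01-∷ b (u , v , eq) = b ∷ u , v , cong (b ∷_) eq

Has01-∷true⁻ : ∀ {w} → Has01 (true ∷ w) → Has01 w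
Has01-∷true⁻ (_ ∷ u , v , eq) = u , v , ∷-injectiveʳ eq

¬Has01-0^ : ∀ b → ¬ Has01 (0^ b)
¬Has01-0^ zero          ([] , _ , ())
¬Has01-0^ zero          (_ ∷ _ , _ , ())
¬Has01-0^ (suc zero)    ([] , _ , ())
¬Has01-0^ (suc (suc b)) ([] , _ , ())
¬Has01-0^ (suc b)       (_ ∷ u , v , eq) = ¬Has01-0^ b (u , v , ∷-injectiveʳ eq)

¬Has01-1^0^ : ∀ a b → ¬ Has01 (1^ a ++ 0^ b)
¬Has01-1^0^ zero    b = ¬Has01-0^ b
¬Has01-1^0^ (suc a) b = ¬Has01-1^0^ a b ∘ Has01-∷true⁻

¬Has01⇒1^0^ : ∀ x → ¬ Has01 x → ∃₂ λ a b → x ≡ 1^ a ++ 0^ b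
¬Has01⇒1^0^ [] _ = 0 , 0 , refl
¬Has01⇒1^0^ (true ∷ x) no01 with ¬Has01⇒1^0^ x (no01 ∘ Has01-∷ true)
... | a , b , refl = suc a , b , refl
¬Has01⇒1^0^ (false ∷ x) no01 with ¬Has01⇒1^0^ x (no01 ∘ Has01-∷ false)
... | zero  , b , refl = 0 , suc b , refl
... | suc a , b , refl = ⊥-elim (no01 ([] , 1^ a ++ 0^ b , refl))

0^-prefix : ∀ y → Σ ℕ λ c → Σ Word λ γ → EmptyOrStarts1 γ × (y ≡ 0^ c ++ γ)
0^-prefix []          = 0 , [] , inj₁ refl , refl
0^-prefix (true ∷ y)  = 0 , true ∷ y , inj₂ (y , refl) , refl
0^-prefix (false ∷ y) with 0^-prefix y
... | c , γ , e , refl = suc c , γ , e , refl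

1^-false-injective : ∀ s s' {z z'} → 1^ s ++ false ∷ z ≡ 1^ s' ++ false ∷ z' → s ≡ s' × z ≡ z'
1^-false-injective zero    zero     refl = refl , refl
1^-false-injective (suc s) (suc s') eq with 1^-false-injective s s' (∷-injectiveʳ eq)
... | refl , refl = refl , refl

0^-injective : ∀ t t' {γ γ'} → EmptyOrStarts1 γ → EmptyOrStarts1 γ' →
               0^ t ++ γ ≡ 0^ t' ++ γ' → t ≡ t' × γ ≡ γ'
0^-injective zero    zero     _                 _                 eq = refl , eq
0^-injective zero    (suc t') (inj₁ refl)       _                 ()
0^-injective zero    (suc t') (inj₂ (_ , refl)) _                 ()
0^-injective (suc t) zero     _                 (inj₁ refl)       ()
0^-injective (suc t) zero     _                 (inj₂ (_ , refl)) ()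
0^-injective (suc t) (suc t') e e' eq with 0^-injective t t' e e' (∷-injectiveʳ eq)
... | refl , refl = refl , refl

parent : ℕ → ℕ → Word → Word
parent s t γ = 1^ suc s ++ 0^ t ++ γ

child : ℕ → ℕ → Word → ℕ → Word
child s t γ i = 1^ s ++ 0^ i ++ true ∷ 0^ (t ∸ i) ++ γ

isChild : ∀ s t γ {i} → EmptyOrStarts1 γ → 1 ≤ i → i ≤ t → IsChild (parent s t γ) i (child s t γ i)
isChild s t γ e 1≤i i≤t = s , t , γ , e , 1≤i , i≤t , refl , refl

parent-injective : ∀ {s s' t t' γ γ'} → 1 ≤ t → 1 ≤ t' → EmptyOrStarts1 γ → EmptyOrStarts1 γ' →
                   parent s t γ ≡ parent s' t' γ' → s ≡ s' × t ≡ t' × γ ≡ γ'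
parent-injective {s} {s'} {suc t} {suc t'} (s≤s z≤n) (s≤s z≤n) e e' eq
  with 1^-false-injective s s' (∷-injectiveʳ eq)
... | refl , eq′ with 0^-injective t t' e e' eq′
... | refl , refl = refl , refl , refl

parent≡child₀ : ∀ s t γ → parent s t γ ≡ child s t γ 0
parent≡child₀ s t γ = replicate-snoc s true (0^ t ++ γ)

child-last : ∀ s t γ → child s t γ t ≡ 1^ s ++ 0^ t ++ true ∷ γ
child-last s t γ = cong (λ r → 1^ s ++ 0^ t ++ true ∷ 0^ r ++ γ) (n∸n≡0 t)

-- The parent's run of zeros is written as t = 1 + i + c, so that no truncated subtraction remains.
child-suc : ∀ s i c γ → child s (suc i + c) γ (suc i) ≡ (1^ s ++ 0^ i) ++ false ∷ true ∷ 0^ c ++ γ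
child-suc s i c γ = begin
  1^ s ++ 0^ suc i ++ true ∷ 0^ (i + c ∸ i) ++ γ
    ≡⟨ cong (λ r → 1^ s ++ 0^ suc i ++ true ∷ 0^ r ++ γ) (m+n∸m≡n i c) ⟩
  1^ s ++ 0^ suc i ++ true ∷ 0^ c ++ γ
    ≡⟨ cong (1^ s ++_) (replicate-snoc i false (true ∷ 0^ c ++ γ)) ⟩
  1^ s ++ 0^ i ++ false ∷ true ∷ 0^ c ++ γ
    ≡⟨ sym (++-assoc (1^ s) (0^ i) _) ⟩
  (1^ s ++ 0^ i) ++ false ∷ true ∷ 0^ c ++ γ ∎

child-pred : ∀ s i c γ → child s (suc i + c) γ i ≡ (1^ s ++ 0^ i) ++ true ∷ false ∷ 0^ c ++ γ
child-pred s i c γ = begin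
  1^ s ++ 0^ i ++ true ∷ 0^ (suc i + c ∸ i) ++ γ
    ≡⟨ cong (λ r → 1^ s ++ 0^ i ++ true ∷ 0^ r ++ γ)
            (trans (+-∸-assoc 1 (m≤m+n i c)) (cong suc (m+n∸m≡n i c))) ⟩
  1^ s ++ 0^ i ++ true ∷ false ∷ 0^ c ++ γ
    ≡⟨ sym (++-assoc (1^ s) (0^ i) _) ⟩
  (1^ s ++ 0^ i) ++ true ∷ false ∷ 0^ c ++ γ ∎

module _ {P : Language} (bubble : IsBubble P) where

  bubble-shiftLeft-step : ∀ s t γ {i} → i < t → P (child s t γ (suc i)) → P (child s t γ i)
  bubble-shiftLeft-step s t γ {i} i<t =
    subst (λ t → P (child s t γ (suc i)) → P (child s t γ i)) (m+[n∸m]≡n i<t) (swap (t ∸ suc i))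
    where
    swap : ∀ c → P (child s (suc i + c) γ (suc i)) → P (child s (suc i + c) γ i)
    swap c p = subst P (sym (child-pred s i c γ))
      (bubble (1^ s ++ 0^ i) (0^ c ++ γ) (¬Has01-1^0^ s i) (subst P (child-suc s i c γ) p))

  bubble-shiftLeft′ : ∀ s t γ {i j} → j ≤′ i → i ≤ t → P (child s t γ i) → P (child s t γ j)
  bubble-shiftLeft′ s t γ ≤′-refl          _   p = p
  bubble-shiftLeft′ s t γ (≤′-step j≤′i) i<t p =
    bubble-shiftLeft′ s t γ j≤′i (<⇒≤ i<t) (bubble-shiftLeft-step s t γ i<t p)

  bubble-shiftLeft : ∀ s t γ {i j} → j ≤ i → i ≤ t → P (child s t γ i) → P (child s t γ j)
  bubble-shiftLeft s t γ = bubble-shiftLeft′ s t γ ∘ ≤⇒≤′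

  bubble⇒parentClosed : ParentClosed P
  bubble⇒parentClosed _ _ _ (s , t , γ , _ , _ , i≤t , refl , refl) p =
    subst P (sym (parent≡child₀ s t γ)) (bubble-shiftLeft s t γ z≤n i≤t p)

  bubble⇒leftSiblingClosed : LeftSiblingClosed P
  bubble⇒leftSiblingClosed _ _ _ _ _ (s , t , γ , e , 1≤i , i≤t , refl , refl)
                                     (s' , t' , γ' , e' , 1≤j , j≤t' , eq , refl) j<i p
    with parent-injective {s} {s'} {t} {t'} {γ} {γ'} (≤-trans 1≤i i≤t) (≤-trans 1≤j j≤t') e e' eq
  ... | refl , refl , refl = bubble-shiftLeft s t γ (<⇒≤ j<i) i≤t p

  bubble-1-to-front : ∀ a b z → P (1^ a ++ 0^ b ++ true ∷ z) → P (1^ suc a ++ 0^ b ++ z)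
  bubble-1-to-front a b z p =
    subst P (sym (parent≡child₀ a b z))
      (bubble-shiftLeft a b z z≤n ≤-refl (subst P (sym (child-last a b z)) p))

  bubble-sort : ∀ a b z → P (1^ a ++ 0^ b ++ z) → P (1^ (a + ones z) ++ 0^ (b + zeros z))
  bubble-sort a b [] p =
    subst₂ (λ a′ b′ → P (1^ a′ ++ 0^ b′)) (sym (+-identityʳ a)) (sym (+-identityʳ b))
      (subst (λ w → P (1^ a ++ w)) (++-identityʳ (0^ b)) p)
  bubble-sort a b (false ∷ z) p =
    subst (λ b′ → P (1^ (a + ones z) ++ 0^ b′)) (sym (+-suc b (zeros z)))
      (bubble-sort a (suc b) z (subst (λ w → P (1^ a ++ w)) (sym (replicate-snoc b false z)) p))
  bubble-sort a b (true ∷ z) p =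
    subst (λ a′ → P (1^ a′ ++ 0^ (b + zeros z))) (sym (+-suc a (ones z)))
      (bubble-sort (suc a) b z (bubble-1-to-front a b z p))

slice-root : ∀ L {n d} w → IsBubble L → Slice L n d w → Slice L n d (root n d)
slice-root L {n} {d} w bubble sw@(_ , inB@(_ , ones≡d)) =
  subst₂ (λ a b → Slice L n d (1^ a ++ 0^ b)) ones≡d (zeros≡length∸ones w inB)
    (bubble-sort (slice-isBubble L n d bubble) 0 0 w sw)

closed⇒shiftLeft : ∀ {S : Language} s t γ {i j} → ParentClosed S → LeftSiblingClosed S →
                   EmptyOrStarts1 γ → 1 ≤ i → i ≤ t → j ≤ i → S (child s t γ i) → S (child s t γ j)
closed⇒shiftLeft {S} s t γ {i} {zero} parentClosed _ e 1≤i i≤t _ p =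
  subst S (parent≡child₀ s t γ)
    (parentClosed (parent s t γ) (child s t γ i) i (isChild s t γ e 1≤i i≤t) p)
closed⇒shiftLeft s t γ {i} {suc j} _ leftSiblingClosed e 1≤i i≤t j≤i p with m≤n⇒m<n∨m≡n j≤i
... | inj₁ j<i  = leftSiblingClosed (parent s t γ) (child s t γ i) (child s t γ (suc j)) i (suc j)
                    (isChild s t γ e 1≤i i≤t)
                    (isChild s t γ e (s≤s z≤n) (≤-trans j≤i i≤t)) j<i p
... | inj₂ refl = p

slices-closed⇒bubble : ∀ {n L} → (∀ w → L w → length w ≡ n) →
  ((d : ℕ) → d ≤ n → ParentClosed (Slice L n d) × LeftSiblingClosed (Slice L n d)) → IsBubble L
slices-closed⇒bubble {n} {L} len closed x y no01 lw
  with ¬Has01⇒1^0^ x no01 | 0^-prefix y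
... | a , b , refl | c , γ , e , refl =
  subst L (child-pred a b c γ)
    (proj₁ (closed⇒shiftLeft a (suc b + c) γ (proj₁ closedᵥ) (proj₂ closedᵥ)
              e (s≤s z≤n) (m≤m+n (suc b) c) (n≤1+n b) (lv , len v lv , refl)))
  where
  v : Word
  v = child a (suc b + c) γ (suc b)
  lv : L v
  lv = subst L (sym (child-suc a b c γ)) lw
  closedᵥ : ParentClosed (Slice L n (ones v)) × LeftSiblingClosed (Slice L n (ones v))
  closedᵥ = closed (ones v) (subst (ones v ≤_) (len v lv) (ones≤length v))

mainTheorem2 : (n : ℕ) (L : Language) → (∀ w → L w → length w ≡ n) →
    (IsBubble L ⇔ ((d : ℕ) → d ≤ n →
        ParentClosed (Slice L n d) × LeftSiblingClosed (Slice L n d)))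
    × (IsBubble L → (d : ℕ) → d ≤ n → Σ Word (Slice L n d) →
        IsRootedSubtree n d (Slice L n d))
mainTheorem2 n L len =
  mk⇔ (λ bubble d _ → bubble⇒parentClosed (slice-isBubble L n d bubble) ,
                       bubble⇒leftSiblingClosed (slice-isBubble L n d bubble))
      (slices-closed⇒bubble len) ,
  λ bubble d _ (w , sw) → slice-root L w bubble sw , bubble⇒parentClosed (slice-isBubble L n d bubble)
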